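{- Fix a finite set $S$ of first-order clauses and a depth limit $d$. Every constraint learned by the constraint-learning search procedure described in the context, run on $S$ with depth limit $d$, is not violated by any closed tableau that is reachable in the clausal connection tableau calculus within depth limit $d$; that is, for every such closed tableau $T^\star$, the learned constraint is not a subset of the set of atoms of the inferences used to construct $T^\star$.
   Context: Clausal connection tableau calculus (free-variable, with a single global substitution $\sigma$, input a finite set $S$ of first-order clauses without equality). Inference rules: (Start) an empty tableau is extended by attaching the literals $L_1,\dots,L_n$ of a clause $C=L_1\vee\dots\vee L_n\in S$ (variables renamed apart from the tableau) as children of the root. (Reduction) an open branch whose leaf literal $L_1$ can be made complementary to a literal $L$ on its path (i.e. $\sigma(\lnot L)=\sigma(L_1)$ after extending $\sigma$ by a unifier) is closed, extending $\sigma$ accordingly. (Extension) below the leaf literal $L$ of an open branch, the literals $L_1,\dots,L_n$ of a renamed copy of a clause $C\in S$ are attached as children, where for the connected literal $L_i$ one requires $\sigma(\lnot L)=\sigma(L_i)$ after extending $\sigma$; the branch through $L_i$ is then closed. A tableau is closed when all branches are closed. Only tableaux whose branches do not exceed the depth limit are considered. Positions: the root is the empty position, and $p.i$ is the $i$-th child of position $p$; variables are named after the position below which their clause is attached, so names are stable under backtracking. Constraint language: an atom is one of $\mathcal{S}_C$ (the tableau was started with clause $C$), $\mathcal{R}^q_p$ (a reduction from position $p$ to an ancestor position $q$), or $\mathcal{E}^C_{p/i}$ (position $p$ was extended by connecting to the $i$-th literal of clause $C$). A constraint is a finite set of atoms. Each applied inference corresponds to an atom; a constraint is violated by a tableau (or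 by a trail) if all of its atoms are among the atoms of the inferences used to build that tableau (respectively, are on the trail). Reasons. Let $T$ be a tableau built by a set of inferences $I$, $B$ an open branch, and $I'\subseteq I$ the inferences needed to produce $B$ (the start step and the extensions along the path to $B$), giving sub-tableau $T'$. If an inference $j$ applicable to $B$ in $T'$ is not applicable in $T$, a reason for its failure is a minimal $E\subseteq I\setminus I'$ such that applying $E$ additionally to $T'$ prevents applying $j$ at $B$. If no inference $j$ among those possible at $B$ in $T'$ can be applied in $T$, a reason that $T$ is stuck is $I'\cup\bigcup_j R_j$, where $R_j$ is a failure reason for $j$ as just defined if the calculus prevents $j$, and $R_j=R'\setminus\{j\}$ if $j$ is prevented because it would complete a previously learned constraint $R'$. Search procedure. Maintain the current tableau $T$ (with $\sigma$), a set of learned constraints (initially empty), and a trail (stack) of atoms of the inferences currently applied (initially empty). Repeat: select an open branch $B$ (for the empty tableau, choose a start clause); initialise a candidate constraint learn to $I'$ for $B$; for each possible inference $j$ at $B$: if $j$ cannot be applied in the calculus, add a failure reason for $j$ to learn; else if some learned constraint $C\cup\{j\}$ is violated by $j$ together with the trail, add $C$ to learn; otherwise apply $j$, push its atom onto the trail, and proceed to the next iteration. If no inference succeeded, pop atoms from the trail (undoing the corresponding inferences) until learn is no longer violated, and record learn as a learned constraint. Stop when $T$ is closed or when the learned constraint is empty. Learned constraints are never forgotten within one depth limit. -}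

module Defs where

open import Data.Bool using (Bool; true; false; _∨_; not)
open import Data.Nat using (ℕ; zero; suc; _≤_; _<_)
import Data.Nat as ℕ
open import Data.List using (List; []; _∷_; length; filterᵇ)
open import Data.List.Properties using (≡-dec)
open import Data.Maybe using (Maybe; just; nothing)
open import Data.Product using (Σ; ∃; ∃₂; _×_; _,_)
open import Data.Sum using (_⊎_)
open import Data.Empty using (⊥)
open import Data.Unit using (⊤)
open import Relation.Nullary using (¬_; ⌊_⌋)
open import Relation.Binary.PropositionalEquality using (_≡_; _≢_)
open import Data.List.Membership.Propositional using (_∈_)
open import Data.List.Relation.Binary.Subset.Propositional using (_⊆_)
import Data.List.Relation.Binary.Sublist.Propositional as SL

data Term (V : Set) : Set where
  var : V → Term V
  fun : ℕ → List (Term V) → Term V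

mutual
  _⟪_⟫ : ∀ {V W : Set} → Term V → (V → Term W) → Term W
  var x ⟪ θ ⟫ = θ x
  fun f ts ⟪ θ ⟫ = fun f (ts ⟪ θ ⟫*)

  _⟪_⟫* : ∀ {V W : Set} → List (Term V) → (V → Term W) → List (Term W)
  [] ⟪ θ ⟫* = []
  (t ∷ ts) ⟪ θ ⟫* = (t ⟪ θ ⟫) ∷ (ts ⟪ θ ⟫*)

record Literal (V : Set) : Set where
  constructor lit
  field
    sign : Bool            -- true = positive literal
    pred : ℕ
    args : List (Term V)

substLit : ∀ {V W : Set} → Literal V → (V → Term W) → Literal W
substLit (lit s P ts) θ = lit s P (ts ⟪ θ ⟫*)

negLit : ∀ {V : Set} → Literal V → Literal V
negLit (lit s P ts) = lit (not s) P ts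

Clause : Set
Clause = List (Literal ℕ)

-- Positions: the root is [], and the i-th child of p is  i ∷ p
-- (positions are stored reversed; children are numbered from 0).
Position : Set
Position = List ℕ

-- Tableau variables are named after the position below which their
-- clause copy is attached: variable x of the copy attached below p is (p , x).
Var : Set
Var = Position × ℕ

rename : Position → Literal ℕ → Literal Var
rename p L = substLit L (λ x → var (p , x))

nth : ∀ {A : Set} → List A → ℕ → Maybe A
nth [] _ = nothing
nth (x ∷ xs) zero = just x
nth (x ∷ xs) (suc n) = nth xs n

data ProperAncestor : Position → Position → Set where
  parent : ∀ {p k} → ProperAncestor p (k ∷ p)
  up     : ∀ {q p k} → ProperAncestor q p → ProperAncestor q (k ∷ p)

-- Constraint atoms = inferences

data Atom : Set where
  start : Clause → Atom
  red   : Position → Position → Atom           -- red p q : R^q_p (from p to ancestor q)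
  ext   : Position → Clause → ℕ → Atom

-- a trail / tableau is the list of applied inferences, most recent first
Trail : Set
Trail = List Atom

LitAt : Trail → Position → Literal Var → Set
LitAt tr [] L = ⊥
LitAt tr (k ∷ []) L =
  Σ Clause λ C → start C ∈ tr × Σ (Literal ℕ) λ L₀ → nth C k ≡ just L₀ × L ≡ rename [] L₀
LitAt tr (k ∷ p@(_ ∷ _)) L =
  Σ Clause λ C → Σ ℕ λ i → ext p C i ∈ tr × Σ (Literal ℕ) λ L₀ → nth C k ≡ just L₀ × L ≡ rename p L₀

Solves : (Var → Term Var) → Trail → Atom → Set
Solves θ tr (start C) = ⊤
Solves θ tr (red p q) = ∀ L L′ → LitAt tr p L → LitAt tr q L′ →
  substLit L θ ≡ substLit (negLit L′) θ
Solves θ tr (ext p C i) = ∀ L L₀ → LitAt tr p L → nth C i ≡ just L₀ →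
  substLit L θ ≡ substLit (negLit (rename p L₀)) θ

-- the global substitution σ exists (σ = mgu of all connection equations)
Unifiable : Trail → Set
Unifiable tr = Σ (Var → Term Var) λ θ → ∀ {a} → a ∈ tr → Solves θ tr a

OpenLeaf : Trail → Position → Set
OpenLeaf tr p =
  (∃ λ L → LitAt tr p L) ×
  (∀ C i → ¬ (ext p C i ∈ tr)) ×
  (∀ q → ¬ (red p q ∈ tr)) ×
  (∀ k p′ C → p ≡ k ∷ p′ → ¬ (ext p′ C k ∈ tr))

-- The calculus with depth limit d (a node at position p has depth length p)

Applicable : List Clause → ℕ → Trail → Atom → Set
Applicable S d tr (start C) = tr ≡ [] × C ∈ S × (C ≡ [] ⊎ 1 ≤ d)
Applicable S d tr (red p q) =
  OpenLeaf tr p × ProperAncestor q p × q ≢ [] × Unifiable (red p q ∷ tr)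
Applicable S d tr (ext p C i) =
  OpenLeaf tr p × C ∈ S × i < length C × suc (length p) ≤ d × Unifiable (ext p C i ∷ tr)

data Valid (S : List Clause) (d : ℕ) : Trail → Set where
  empty : Valid S d []
  step  : ∀ {tr a} → Applicable S d tr a → Valid S d tr → Valid S d (a ∷ tr)

Started : Trail → Set
Started tr = ∃ λ C → start C ∈ tr

Closed : Trail → Set
Closed tr = Started tr × (∀ p → ¬ OpenLeaf tr p)

isAncestorᵇ : Position → Position → Bool
isAncestorᵇ q [] = false
isAncestorᵇ q (k ∷ p) = ⌊ ≡-dec ℕ._≟_ q p ⌋ ∨ isAncestorᵇ q p

onPathᵇ : Position → Atom → Bool
onPathᵇ B (start _) = true
onPathᵇ B (red _ _) = false
onPathᵇ B (ext q _ _) = isAncestorᵇ q B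

-- I′ : the inferences needed to produce the branch ending at B
PathInfs : Trail → Position → Trail
PathInfs tr B = filterᵇ (onPathᵇ B) tr

-- an inference at branch B (B = [] is the branch of the empty tableau)
AtBranch : Atom → Position → Set
AtBranch (start _) B = B ≡ []
AtBranch (red p _) B = p ≡ B
AtBranch (ext p _ _) B = p ≡ B

Selectable : Trail → Position → Set
Selectable tr B = (B ≡ [] × tr ≡ []) ⊎ OpenLeaf tr B

-- possible inferences at B: those applicable at B in T′
Possible : List Clause → ℕ → Trail → Position → Atom → Set
Possible S d tr B j = AtBranch j B × Applicable S d (PathInfs tr B) j

-- tr′ is the tableau T′ with E additionally applied (in trail order)
SubTableau : Trail → Trail → List Atom → Trail → Set
SubTableau tr I′ E tr′ =
  tr′ SL.⊆ tr ×
  (∀ {a} → a ∈ tr′ → a ∈ I′ ⊎ a ∈ E) ×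
  (∀ {a} → a ∈ I′ ⊎ a ∈ E → a ∈ tr′)

Prevents : List Clause → ℕ → Trail → Position → Atom → List Atom → Set
Prevents S d tr B j E = Σ Trail λ tr′ →
  SubTableau tr (PathInfs tr B) E tr′ × Valid S d tr′ × ¬ Applicable S d tr′ j

FailureReason : List Clause → ℕ → Trail → Position → Atom → List Atom → Set
FailureReason S d tr B j E =
  E ⊆ tr × (∀ {a} → a ∈ E → ¬ (a ∈ PathInfs tr B)) ×
  Prevents S d tr B j E ×
  (∀ E′ → E′ ⊆ E → Prevents S d tr B j E′ → E ⊆ E′)

Blocked : List (List Atom) → Trail → Atom → Set
Blocked ls tr j = ∃ λ R′ → R′ ∈ ls × j ∈ R′ × R′ ⊆ (j ∷ tr)

BlockReason : List (List Atom) → Trail → Atom → List Atom → Set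
BlockReason ls tr j R = ∃ λ R′ → R′ ∈ ls × j ∈ R′ × R′ ⊆ (j ∷ tr) ×
  (∀ {a} → a ∈ R → a ∈ R′ × a ≢ j) × (∀ {a} → a ∈ R′ → a ≢ j → a ∈ R)

StuckReason : List Clause → ℕ → List (List Atom) → Trail → Position → List Atom → Set
StuckReason S d ls tr B K =
  Σ (∀ j → Possible S d tr B j → List Atom) λ R →
    (∀ j (pj : Possible S d tr B j) →
       (¬ Applicable S d tr j × FailureReason S d tr B j (R j pj)) ⊎
       (Applicable S d tr j × BlockReason ls tr j (R j pj))) ×
    (∀ {a} → a ∈ K → a ∈ PathInfs tr B ⊎ (∃₂ λ j pj → a ∈ R j pj)) ×
    (∀ {a} → a ∈ PathInfs tr B ⊎ (∃₂ λ j pj → a ∈ R j pj) → a ∈ K)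

data Pop (K : List Atom) : Trail → Trail → Set where
  done      : ∀ {tr} → ¬ (K ⊆ tr) → Pop K tr tr
  exhausted : K ⊆ [] → Pop K [] []
  pop       : ∀ {a tr tr′} → K ⊆ (a ∷ tr) → Pop K tr tr′ → Pop K (a ∷ tr) tr′

record SState : Set where
  constructor ⟨_,_⟩
  field
    trail   : Trail
    learned : List (List Atom)
open SState public

Running : Trail → List (List Atom) → Set
Running tr ls = ¬ Closed tr × ¬ ([] ∈ ls)

data Step (S : List Clause) (d : ℕ) : SState → SState → Set where
  apply : ∀ {tr ls B j} → Running tr ls → Selectable tr B →
          Possible S d tr B j → Applicable S d tr j → ¬ Blocked ls tr j →
          Step S d ⟨ tr , ls ⟩ ⟨ j ∷ tr , ls ⟩
  learn : ∀ {tr ls B K tr′} → Running tr ls → Selectable tr B →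
          StuckReason S d ls tr B K → Pop K tr tr′ →
          Step S d ⟨ tr , ls ⟩ ⟨ tr′ , K ∷ ls ⟩

initial : SState
initial = ⟨ [] , [] ⟩

module Submission where

open import Defs
open import Data.Nat using (ℕ)
open import Data.List using (List)
open import Relation.Nullary using (¬_)
open import Data.List.Membership.Propositional using (_∈_)
open import Data.List.Relation.Binary.Subset.Propositional using (_⊆_)
open import Relation.Binary.Construct.Closure.ReflexiveTransitive using (Star)

-- Invariant: no learned constraint is contained in a closed tableau T.  Let K be
-- learned at branch B of T′ and suppose K ⊆ T.  Then I′ ⊆ K ⊆ T, so B is a
-- branch of T, and since T is closed, T contains an inference j at B.  This j
-- was possible at B in T′, so K accounts for it by a reason R ⊆ K ⊆ T.  A
-- failure reason names a tableau between T′ and T in which j would still be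
-- applicable: B is still an open leaf there, and the unifier of T also solves
-- its connections.  A blocking reason R = R′ ∖ {j} gives R′ ⊆ T for an earlier
-- learned R′, contradicting the invariant.

import Data.Bool as Bool
open import Data.Bool.Properties using (T?; T-∨)
import Data.Nat as ℕ
open import Data.List using ([]; _∷_)
open import Data.List.Properties using (≡-dec)
open import Data.List.Relation.Unary.Any using (here; there)
open import Data.List.Relation.Unary.All as All using (All; []; _∷_)
open import Data.List.Relation.Binary.Subset.Propositional.Properties using (⊆[]⇒≡[]; ∈-∷⁺ʳ)
open import Data.List.Relation.Binary.Sublist.Propositional.Properties using (Any-resp-⊆)
import Data.List.Membership.Propositional.Properties as ∈
open import Data.Product using (Σ; _,_; proj₁; proj₂)
open import Data.Sum using (inj₁; inj₂; [_,_]′)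
open import Data.Unit using (tt)
open import Function using (_∘_; id; case_of_; Equivalence)
open import Relation.Nullary.Decidable using (⌊_⌋; fromWitness)
open import Relation.Binary.PropositionalEquality using (_≡_; refl)
open import Relation.Binary.Construct.Closure.ReflexiveTransitive using (ε; _◅_)

PathInfs-⊆ : ∀ tr B → PathInfs tr B ⊆ tr
PathInfs-⊆ tr B = proj₁ ∘ ∈.∈-filter⁻ (T? ∘ onPathᵇ B)

∈-PathInfs⁺ : ∀ {tr a} B → a ∈ tr → Bool.T (onPathᵇ B a) → a ∈ PathInfs tr B
∈-PathInfs⁺ B = ∈.∈-filter⁺ (T? ∘ onPathᵇ B)

isAncestorᵇ-parent : ∀ k p → Bool.T (isAncestorᵇ p (k ∷ p))
isAncestorᵇ-parent k p = Equivalence.from (T-∨ {⌊ ≡-dec ℕ._≟_ p p ⌋}) (inj₁ (fromWitness refl))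

LitAt-mono : ∀ {X Y} p {L} → X ⊆ Y → LitAt X p L → LitAt Y p L
LitAt-mono (k ∷ [])    X⊆Y (C , s∈X , L₀) = C , X⊆Y s∈X , L₀
LitAt-mono (k ∷ _ ∷ _) X⊆Y (C , i , e∈X , L₀) = C , i , X⊆Y e∈X , L₀

LitAt-PathInfs : ∀ tr B {L} → LitAt tr B L → LitAt (PathInfs tr B) B L
LitAt-PathInfs tr (k ∷ [])    (C , s∈tr , L₀) = C , ∈-PathInfs⁺ (k ∷ []) s∈tr tt , L₀
LitAt-PathInfs tr (k ∷ p@(_ ∷ _)) (C , i , e∈tr , L₀) =
  C , i , ∈-PathInfs⁺ (k ∷ p) e∈tr (isAncestorᵇ-parent k p) , L₀

¬OpenLeaf-root : ∀ {tr} → ¬ OpenLeaf tr []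
¬OpenLeaf-root ((_ , ()) , _)

Solves-antimono : ∀ θ {X Y} a → X ⊆ Y → Solves θ Y a → Solves θ X a
Solves-antimono θ (start C)   X⊆Y sol = tt
Solves-antimono θ (red p q)   X⊆Y sol L L′ l l′ = sol L L′ (LitAt-mono p X⊆Y l) (LitAt-mono q X⊆Y l′)
Solves-antimono θ (ext p C i) X⊆Y sol L L₀ l e = sol L L₀ (LitAt-mono p X⊆Y l) e

Unifiable-antimono : ∀ {X Y} → X ⊆ Y → Unifiable Y → Unifiable X
Unifiable-antimono X⊆Y (θ , sol) = θ , λ {a} a∈X → Solves-antimono θ a X⊆Y (sol (X⊆Y a∈X))

Selectable-leaf : ∀ {tr₀ tr B} → OpenLeaf tr₀ B → Selectable tr B → OpenLeaf tr B
Selectable-leaf leaf (inj₁ (refl , _)) with () ← ¬OpenLeaf-root leaf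
Selectable-leaf _    (inj₂ leaf)       = leaf

OpenLeaf-restrict : ∀ {tr tr′ B} → OpenLeaf tr B →
                    PathInfs tr B ⊆ tr′ → tr′ ⊆ tr → OpenLeaf tr′ B
OpenLeaf-restrict {tr} {B = B} ((L , l) , ¬ext , ¬red , ¬extParent) I′⊆tr′ tr′⊆tr =
  (L , LitAt-mono B I′⊆tr′ (LitAt-PathInfs tr B l)) ,
  (λ C i → ¬ext C i ∘ tr′⊆tr) ,
  (λ q → ¬red q ∘ tr′⊆tr) ,
  (λ k p C eq → ¬extParent k p C eq ∘ tr′⊆tr)

¬¬-⊆ : ∀ {A : Set} {xs ys : List A} → (∀ {x} → x ∈ xs → ¬ ¬ (x ∈ ys)) → ¬ ¬ (xs ⊆ ys)
¬¬-⊆ {xs = []}     _   ¬xs⊆ys = ¬xs⊆ys λ ()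
¬¬-⊆ {xs = x ∷ xs} ¬¬∈ ¬xs⊆ys =
  ¬¬∈ (here refl) λ x∈ys → ¬¬-⊆ (¬¬∈ ∘ there) λ xs⊆ys → ¬xs⊆ys (∈-∷⁺ʳ x∈ys xs⊆ys)

module _ {S : List Clause} {d : ℕ} where

  Valid⇒Unifiable : ∀ {tr} → Valid S d tr → Unifiable tr
  Valid⇒Unifiable empty = var , λ ()
  Valid⇒Unifiable (step {a = start C} (refl , _) _)   = var , λ { (here refl) → tt }
  Valid⇒Unifiable (step {a = red p q}   (_ , _ , _ , unif) _) = unif
  Valid⇒Unifiable (step {a = ext p C i} (_ , _ , _ , _ , unif) _) = unif

  Valid-applied : ∀ {tr a} → Valid S d tr → a ∈ tr → Σ Trail λ tr₀ → Applicable S d tr₀ a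
  Valid-applied (step app _) (here refl) = _ , app
  Valid-applied (step _ v)   (there a∈tr) = Valid-applied v a∈tr

  Valid-ext-functional : ∀ {tr p C C′ i i′} → Valid S d tr →
                         ext p C i ∈ tr → ext p C′ i′ ∈ tr → ext p C i ≡ ext p C′ i′
  Valid-ext-functional (step _ _) (here refl) (here refl) = refl
  Valid-ext-functional (step ((_ , ¬ext , _) , _) _) (here refl) (there e′) with () ← ¬ext _ _ e′
  Valid-ext-functional (step ((_ , ¬ext , _) , _) _) (there e) (here refl) with () ← ¬ext _ _ e
  Valid-ext-functional (step _ v) (there e) (there e′) = Valid-ext-functional v e e′

  -- Only openness of B depends on tr′; the other side conditions of j come from the step that applied j in T.
  Applicable-restrict : ∀ {tr tr′ T B j} → Valid S d T → j ∈ T → AtBranch j B →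
                        Selectable tr B → PathInfs tr B ⊆ tr′ → tr′ ⊆ tr → tr′ ⊆ T →
                        Applicable S d tr′ j
  Applicable-restrict {j = start C} v j∈T refl (inj₁ (_ , refl)) _ tr′⊆tr _
    with _ , (_ , C∈S , depth) ← Valid-applied v j∈T = ⊆[]⇒≡[] tr′⊆tr , C∈S , depth
  Applicable-restrict {j = start C} _ _ refl (inj₂ leaf) _ _ _ with () ← ¬OpenLeaf-root leaf
  Applicable-restrict {j = red p q} v j∈T refl sel I′⊆tr′ tr′⊆tr tr′⊆T
    with _ , (leaf , anc , q≢root , _) ← Valid-applied v j∈T =
    OpenLeaf-restrict (Selectable-leaf leaf sel) I′⊆tr′ tr′⊆tr , anc , q≢root ,
    Unifiable-antimono (∈-∷⁺ʳ j∈T tr′⊆T) (Valid⇒Unifiable v)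
  Applicable-restrict {j = ext p C i} v j∈T refl sel I′⊆tr′ tr′⊆tr tr′⊆T
    with _ , (leaf , C∈S , i<∣C∣ , depth , _) ← Valid-applied v j∈T =
    OpenLeaf-restrict (Selectable-leaf leaf sel) I′⊆tr′ tr′⊆tr , C∈S , i<∣C∣ , depth ,
    Unifiable-antimono (∈-∷⁺ʳ j∈T tr′⊆T) (Valid⇒Unifiable v)

  Sound : List Atom → Set
  Sound K = ∀ T → Valid S d T → Closed T → ¬ (K ⊆ T)

  ¬Prevents : ∀ {tr T B j E} → Valid S d T → j ∈ T → AtBranch j B → Selectable tr B →
              PathInfs tr B ⊆ T → E ⊆ T → ¬ Prevents S d tr B j E
  ¬Prevents {T = T} v j∈T atB sel I′⊆T E⊆T (tr′ , (tr′⊑tr , tr′⊆I′∪E , I′∪E⊆tr′) , _ , ¬app) =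
    ¬app (Applicable-restrict v j∈T atB sel (I′∪E⊆tr′ ∘ inj₁) (Any-resp-⊆ tr′⊑tr) tr′⊆T)
    where
    tr′⊆T : tr′ ⊆ T
    tr′⊆T a∈tr′ = [ I′⊆T , E⊆T ]′ (tr′⊆I′∪E a∈tr′)

  -- Without decidable equality of atoms, R′ ⊆ {j} ∪ R only gives ¬ ¬ (R′ ⊆ T).
  ¬BlockReason : ∀ {ls tr T j R} → All Sound ls → Valid S d T → Closed T →
                 j ∈ T → R ⊆ T → ¬ BlockReason ls tr j R
  ¬BlockReason sound v closed j∈T R⊆T (R′ , R′∈ls , _ , _ , _ , R′∖j⊆R) =
    ¬¬-⊆ R′⊆T (All.lookup sound R′∈ls _ v closed)
    where
    R′⊆T : ∀ {a} → a ∈ R′ → ¬ ¬ (a ∈ _)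
    R′⊆T a∈R′ a∉T = a∉T (R⊆T (R′∖j⊆R a∈R′ λ { refl → a∉T j∈T }))

  StuckReason⇒¬AtBranch : ∀ {ls tr B K T j} → All Sound ls → StuckReason S d ls tr B K →
                          Selectable tr B → Valid S d T → Closed T → K ⊆ T →
                          j ∈ T → ¬ AtBranch j B
  StuckReason⇒¬AtBranch {tr = tr} {B} {j = j} sound (R , reason , _ , ⊆K) sel v closed K⊆T j∈T atB =
    case reason j possible of λ where
      (inj₁ (_ , _ , _ , prevents , _)) → ¬Prevents v j∈T atB sel I′⊆T Rj⊆T prevents
      (inj₂ (_ , block))               → ¬BlockReason sound v closed j∈T Rj⊆T block
    where
    I′⊆T : PathInfs tr B ⊆ _
    I′⊆T = K⊆T ∘ ⊆K ∘ inj₁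
    possible : Possible S d tr B j
    possible = atB , Applicable-restrict v j∈T atB sel id (PathInfs-⊆ tr B) I′⊆T
    Rj⊆T : R j possible ⊆ _
    Rj⊆T = K⊆T ∘ ⊆K ∘ inj₂ ∘ (j ,_) ∘ (possible ,_)

  -- The clause attached above a leaf of tr is the one T attaches there, so T does not close it either.
  OpenLeaf-parent-open : ∀ {tr T B} → Valid S d T → OpenLeaf tr B → PathInfs tr B ⊆ T →
                         ∀ k p C → B ≡ k ∷ p → ¬ (ext p C k ∈ T)
  OpenLeaf-parent-open v leaf _ k [] C refl e∈T
    with _ , (leaf₀ , _) ← Valid-applied v e∈T with () ← ¬OpenLeaf-root leaf₀
  OpenLeaf-parent-open v ((_ , C′ , i , e′∈tr , _) , _ , _ , ¬extParent) I′⊆T k p@(_ ∷ _) C refl e∈T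
    with refl ← Valid-ext-functional v e∈T (I′⊆T (∈-PathInfs⁺ (k ∷ p) e′∈tr (isAncestorᵇ-parent k p)))
    = ¬extParent k p C refl e′∈tr

  OpenLeaf-extend : ∀ {tr T B} → Valid S d T → OpenLeaf tr B → PathInfs tr B ⊆ T →
                    (∀ C i → ¬ (ext B C i ∈ T)) → (∀ q → ¬ (red B q ∈ T)) → OpenLeaf T B
  OpenLeaf-extend {tr} {T} {B} v leaf@((L , l) , _) I′⊆T ¬ext ¬red =
    (L , LitAt-mono B I′⊆T (LitAt-PathInfs tr B l)) , ¬ext , ¬red , OpenLeaf-parent-open v leaf I′⊆T

  StuckReason-sound : ∀ {ls tr B K} → All Sound ls → StuckReason S d ls tr B K →
                      Selectable tr B → Sound K
  StuckReason-sound sound stuck sel@(inj₁ (refl , _)) T v closed K⊆T =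
    StuckReason⇒¬AtBranch sound stuck sel v closed K⊆T (proj₂ (proj₁ closed)) refl
  StuckReason-sound {B = B} sound stuck@(_ , _ , _ , ⊆K) sel@(inj₂ leaf) T v closed K⊆T =
    proj₂ closed B
      (OpenLeaf-extend v leaf (K⊆T ∘ ⊆K ∘ inj₁) (λ _ _ e → unused e refl) (λ _ e → unused e refl))
    where
    unused : ∀ {j} → j ∈ T → ¬ AtBranch j B
    unused = StuckReason⇒¬AtBranch sound stuck sel v closed K⊆T

  Step-sound : ∀ {s s′} → Step S d s s′ → All Sound (learned s) → All Sound (learned s′)
  Step-sound (apply _ _ _ _ _)    sound = sound
  Step-sound (learn _ sel stuck _) sound = StuckReason-sound sound stuck sel ∷ sound

  Star-sound : ∀ {s s′} → Star (Step S d) s s′ → All Sound (learned s) → All Sound (learned s′)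
  Star-sound ε          sound = sound
  Star-sound (st ◅ run) sound = Star-sound run (Step-sound st sound)

lemma2 : (S : List Clause) (d : ℕ) (st : SState) → Star (Step S d) initial st →
         (K : List Atom) → K ∈ learned st →
         (T : Trail) → Valid S d T → Closed T → ¬ (K ⊆ T)
lemma2 S d st run K K∈learned = All.lookup (Star-sound run []) K∈learned
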